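{- For any $n\ge1$ and $\alpha\in\mathbb{Z}^n$, writing $-\alpha=(-\alpha_1,\dots,-\alpha_n)$, \[ \mathrm{Tes}_{ -\alpha}(q,t)=\left(-\frac{1}{qt}\right)^n\mathrm{Tes}_\alpha(1/q,1/t). \]
   Context: Tesler matrices: an $m\times m$ integer matrix $U$ is a Tesler matrix if it is upper triangular, has no zero row, and every row is entirely nonnegative or entirely nonpositive. Hook sums: $\operatorname{hooks}_i(U)=(U_{i,i}+\dots+U_{i,m})-(U_{1,i}+\dots+U_{i-1,i})$; $\mathrm{Tes}(\alpha)$ is the set of $m\times m$ Tesler matrices with $\operatorname{hooks}(U)=\alpha\in\mathbb{Z}^m$. Let $M=(1-q)(1-t)$ and $[k]_{q,t}=(q^k-t^k)/(q-t)$ for $k\in\mathbb{Z}$; $\operatorname{wt}(U;q,t)=(-1)^{\operatorname{entries}^+(U)-\operatorname{rows}^+(U)}M^{\operatorname{nonzero}(U)-m}\prod_{U_{i,j}\neq0}[U_{i,j}]_{q,t}$, where $\operatorname{entries}^+$ counts positive entries, $\operatorname{rows}^+$ counts rows whose nonzero entries are all positive, and $\operatorname{nonzero}$ counts nonzero entries. $\mathrm{Tes}_\alpha(q,t)=\sum_{U\in\mathrm{Tes}(\alpha)}\operatorname{wt}(U;q,t)\in\mathbb{Z}[q,t,1/q,1/t]$. -}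

module Defs where

open import Level using (Level)
open import Data.Bool using (Bool; true; false; if_then_else_; _∨_)
open import Data.Nat as ℕ using (ℕ; zero; suc; _∸_)
open import Data.Integer as ℤ using (ℤ; +_; -[1+_]; 0ℤ)
open import Data.Fin using (Fin; toℕ)
open import Data.Vec using (Vec; lookup; tabulate)
open import Data.List as List using (List; []; _∷_; allFin; filter; length)
open import Data.List.Membership.Propositional using (_∈_)
open import Data.List.Relation.Unary.Unique.Propositional using (Unique)
open import Data.Product using (_×_; ∃)
open import Data.Sum using (_⊎_)
open import Relation.Nullary using (¬_; does)
open import Relation.Binary.PropositionalEquality using (_≡_)
open import Algebra.Bundles using (CommutativeRing)

Matrix : ℕ → Set
Matrix m = Vec (Vec ℤ m) m

entry : ∀ {m} → Matrix m → Fin m → Fin m → ℤ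
entry U i j = lookup (lookup U i) j

Σℤ : ∀ m → (Fin m → ℤ) → ℤ
Σℤ m f = List.foldr ℤ._+_ 0ℤ (List.map f (allFin m))

sumℕ : List ℕ → ℕ
sumℕ = List.foldr ℕ._+_ 0

allB : ∀ {A : Set} → (A → Bool) → List A → Bool
allB p = List.foldr (λ x b → p x Data.Bool.∧ b) true

count : ∀ m → (Fin m → Bool) → ℕ
count m p = List.foldr (λ b k → if b then suc k else k) 0 (List.map p (allFin m))

IsTesler : ∀ {m} → Matrix m → Set
IsTesler {m} U =
  (∀ (i j : Fin m) → toℕ j ℕ.< toℕ i → entry U i j ≡ 0ℤ)
  × (∀ (i : Fin m) → ∃ λ (j : Fin m) → ¬ (entry U i j ≡ 0ℤ))
  × (∀ (i : Fin m) → (∀ (j : Fin m) → 0ℤ ℤ.≤ entry U i j)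
                     ⊎ (∀ (j : Fin m) → entry U i j ℤ.≤ 0ℤ))

hook : ∀ {m} → Matrix m → Fin m → ℤ
hook {m} U i =
  Σℤ m (λ j → if does (toℕ i ℕ.≤? toℕ j) then entry U i j else 0ℤ)
  ℤ.- Σℤ m (λ k → if does (toℕ k ℕ.<? toℕ i) then entry U k i else 0ℤ)

hooks : ∀ {m} → Matrix m → Vec ℤ m
hooks U = tabulate (hook U)

InTes : ∀ {m} → Vec ℤ m → Matrix m → Set
InTes α U = IsTesler U × hooks U ≡ α

IsTesEnum : ∀ {m} → Vec ℤ m → List (Matrix m) → Set
IsTesEnum {m} α L = Unique L × (∀ (U : Matrix m) → (U ∈ L → InTes α U) × (InTes α U → U ∈ L))

negVec : ∀ {m} → Vec ℤ m → Vec ℤ m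
negVec = Data.Vec.map (λ x → ℤ.- x)

isZero : ℤ → Bool
isZero x = does (x ℤ.≟ 0ℤ)

isPos : ℤ → Bool
isPos x = does (0ℤ ℤ.<? x)

entriesPos : ∀ {m} → Matrix m → ℕ
entriesPos {m} U = sumℕ (List.map (λ i → count m (λ j → isPos (entry U i j))) (allFin m))

rowsPos : ∀ {m} → Matrix m → ℕ
rowsPos {m} U = count m (λ i → allB (λ j → isZero (entry U i j) ∨ isPos (entry U i j)) (allFin m))

nonzero : ∀ {m} → Matrix m → ℕ
nonzero {m} U = sumℕ (List.map (λ i → count m (λ j → Data.Bool.not (isZero (entry U i j)))) (allFin m))

-- Weights, evaluated in a commutative ring R at invertible q, t.
-- The arguments are (q, q⁻¹, t, t⁻¹); the inverses are needed because
-- [k]_{q,t} for k < 0 is a Laurent polynomial.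

module _ {c ℓ : Level} (R : CommutativeRing c ℓ) where
  open CommutativeRing R

  pow : Carrier → ℕ → Carrier
  pow x zero = 1#
  pow x (suc k) = x * pow x k

  Σᴿ : ∀ m → (Fin m → Carrier) → Carrier
  Σᴿ m f = List.foldr _+_ 0# (List.map f (allFin m))

  Πᴿ : ∀ m → (Fin m → Carrier) → Carrier
  Πᴿ m f = List.foldr _*_ 1# (List.map f (allFin m))

  -- [k]_{q,t} = (q^k - t^k)/(q - t) written out as a Laurent polynomial:
  --   [0] = 0,
  --   [k] = Σ_{a=0}^{k-1} q^a t^{k-1-a}                 for k > 0,
  --   [-k] = -(q⁻¹ t⁻¹)^k [k]                            for k > 0.
  qtPos : Carrier → Carrier → ℕ → Carrier   -- [k+1]_{q,t}
  qtPos q t k = Σᴿ (suc k) (λ a → pow q (toℕ a) * pow t (k ∸ toℕ a))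

  qtInt : (q q⁻¹ t t⁻¹ : Carrier) → ℤ → Carrier
  qtInt q q⁻¹ t t⁻¹ (+ zero) = 0#
  qtInt q q⁻¹ t t⁻¹ (+ (suc k)) = qtPos q t k
  qtInt q q⁻¹ t t⁻¹ (-[1+ k ]) = - (pow (q⁻¹ * t⁻¹) (suc k) * qtPos q t k)

  Mqt : Carrier → Carrier → Carrier
  Mqt q t = (1# - q) * (1# - t)

  wt : (q q⁻¹ t t⁻¹ : Carrier) → ∀ {m} → Matrix m → Carrier
  wt q q⁻¹ t t⁻¹ {m} U =
    pow (- 1#) (entriesPos U ∸ rowsPos U)
    * (pow (Mqt q t) (nonzero U ∸ m)
    * Πᴿ m (λ i → Πᴿ m (λ j → if isZero (entry U i j) then 1#
                                else qtInt q q⁻¹ t t⁻¹ (entry U i j))))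

  -- Σ_{U ∈ L} wt(U;q,t); with L an enumeration of Tes(α) this is Tes_α(q,t)
  TesSum : (q q⁻¹ t t⁻¹ : Carrier) → ∀ {m} → List (Matrix m) → Carrier
  TesSum q q⁻¹ t t⁻¹ L = List.foldr _+_ 0# (List.map (wt q q⁻¹ t t⁻¹) L)

module Submission where

open import Defs
open import Data.Nat using (ℕ; _≤_)
open import Data.Integer using (ℤ)
open import Data.Vec using (Vec)
open import Data.List using (List)
open import Algebra.Bundles using (CommutativeRing)
open import Data.List using (map)
open import Data.Product using (proj₁; proj₂)

-- Negating every entry maps Tes(α) bijectively onto Tes(−α): the Tesler conditions are
-- symmetric under a change of sign and the hooks are linear. So it suffices to show
-- wt(−U; q, t) = (−1/(qt))^n wt(U; 1/q, 1/t) for one Tesler matrix U with N nonzero entries.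
-- Every nonzero entry k contributes [−k]_{q,t} = −(1/(qt)) [k]_{1/q,1/t}, a factor (−1/(qt))^N
-- in all. Since each row of U is nonzero and of constant sign, the numbers of positive entries
-- of U and −U add up to N and their numbers of positive rows add up to n, so the two sign
-- exponents add up to N − n. Writing (−1/(qt))^N = (−1/(qt))^n (−1/(qt))^(N−n), the factors of
-- exponent N − n combine, by −M_{q,t} · (−1/(qt)) = M_{1/q,1/t}, into the power of M_{1/q,1/t}.

module TeslerNegation where

  open import Function using (_∘_)
  open import Function.Bundles using (mk⇔)
  open import Data.Bool using (Bool; true; false; if_then_else_; not; _∨_)
  open import Data.Bool.Properties using (if-float; ∧-zeroʳ)
  open import Data.Nat as ℕ using (suc; _+_; _∸_; z≤n)
  import Data.Nat.Properties as ℕ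
  open import Data.Integer as ℤ using (+0; +[1+_]; -[1+_]; 0ℤ; -_)
  import Data.Integer.Properties as ℤ
  open import Data.Fin using (Fin; toℕ)
  import Data.Vec as Vec
  import Data.Vec.Properties as Vec
  open import Data.List as List using ([]; _∷_; allFin)
  import Data.List.Properties as List
  open import Data.List.Membership.Propositional using (_∈_)
  open import Data.List.Membership.Propositional.Properties
    using (∈-allFin; ∈-map⁺; ∈-map⁻)
  open import Data.List.Membership.Propositional.Properties.WithK using (unique∧set⇒bag)
  open import Data.List.Relation.Unary.Any using (here; there)
  open import Data.List.Relation.Unary.Unique.Propositional using (Unique)
  import Data.List.Relation.Unary.Unique.Propositional.Properties as Unique
  open import Data.List.Relation.Binary.BagAndSetEquality using (∼bag⇒↭)
  open import Data.List.Relation.Binary.Permutation.Propositional using (_↭_)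
  open import Data.Product using (_×_; _,_; ∃)
  open import Data.Sum using (_⊎_; inj₁; inj₂)
  open import Relation.Nullary using (¬_; does)
  open import Algebra.Properties.CommutativeSemigroup ℕ.+-commutativeSemigroup
    using () renaming (interchange to +-interchange)
  open import Relation.Binary.PropositionalEquality
    using (_≡_; refl; sym; trans; cong; cong₂; subst; subst₂; module ≡-Reasoning)

  indicator : Bool → ℕ
  indicator true = 1
  indicator false = 0

  -- Defs.count m p is definitionally countBy p (allFin m), and entriesPos, nonzero are
  -- definitionally sums sumBy f (allFin m).
  module _ {A : Set} where

    sumBy : (A → ℕ) → List A → ℕ
    sumBy f xs = sumℕ (map f xs)

    countBy : (A → Bool) → List A → ℕ
    countBy p xs = List.foldr (λ b k → if b then suc k else k) 0 (map p xs)

    countBy≡sumBy : ∀ p xs → countBy p xs ≡ sumBy (indicator ∘ p) xs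
    countBy≡sumBy p [] = refl
    countBy≡sumBy p (x ∷ xs) with p x
    ... | true = cong suc (countBy≡sumBy p xs)
    ... | false = countBy≡sumBy p xs

    sumBy-cong : ∀ {f g : A → ℕ} → (∀ x → f x ≡ g x) → ∀ xs → sumBy f xs ≡ sumBy g xs
    sumBy-cong f≗g xs = cong sumℕ (List.map-cong f≗g xs)

    sumBy-+ : ∀ f g xs → sumBy f xs + sumBy g xs ≡ sumBy (λ x → f x + g x) xs
    sumBy-+ f g [] = refl
    sumBy-+ f g (x ∷ xs) =
      trans (+-interchange (f x) _ (g x) _) (cong ((f x + g x) +_) (sumBy-+ f g xs))

    sumBy-mono-≤ : ∀ {f g : A → ℕ} → (∀ x → f x ≤ g x) → ∀ xs → sumBy f xs ≤ sumBy g xs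
    sumBy-mono-≤ f≤g [] = z≤n
    sumBy-mono-≤ f≤g (x ∷ xs) = ℕ.+-mono-≤ (f≤g x) (sumBy-mono-≤ f≤g xs)

    ∈⇒≤sumBy : ∀ f {x xs} → x ∈ xs → f x ≤ sumBy f xs
    ∈⇒≤sumBy f {xs = y ∷ xs} (here refl) = ℕ.m≤m+n (f y) _
    ∈⇒≤sumBy f {xs = y ∷ xs} (there x∈xs) =
      ℕ.≤-trans (∈⇒≤sumBy f x∈xs) (ℕ.m≤n+m _ (f y))

    sumBy-1 : ∀ xs → sumBy (λ _ → 1) xs ≡ List.length xs
    sumBy-1 [] = refl
    sumBy-1 (x ∷ xs) = cong suc (sumBy-1 xs)

    countBy-cong : ∀ {p p′ : A → Bool} → (∀ x → p x ≡ p′ x) →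
                   ∀ xs → countBy p xs ≡ countBy p′ xs
    countBy-cong p≗p′ xs = cong (List.foldr _ 0) (List.map-cong p≗p′ xs)

    countBy-+ : ∀ p p′ r → (∀ x → indicator (p x) + indicator (p′ x) ≡ indicator (r x)) →
                ∀ xs → countBy p xs + countBy p′ xs ≡ countBy r xs
    countBy-+ p p′ r split xs = begin
      countBy p xs + countBy p′ xs
        ≡⟨ cong₂ _+_ (countBy≡sumBy p xs) (countBy≡sumBy p′ xs) ⟩
      sumBy (indicator ∘ p) xs + sumBy (indicator ∘ p′) xs
        ≡⟨ sumBy-+ (indicator ∘ p) (indicator ∘ p′) xs ⟩
      sumBy (λ x → indicator (p x) + indicator (p′ x)) xs
        ≡⟨ sumBy-cong split xs ⟩
      sumBy (indicator ∘ r) xs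
        ≡⟨ countBy≡sumBy r xs ⟨
      countBy r xs ∎
      where open ≡-Reasoning

    countBy-∈ : ∀ p {x xs} → x ∈ xs → p x ≡ true → 1 ≤ countBy p xs
    countBy-∈ p {x} {xs} x∈xs px rewrite countBy≡sumBy p xs =
      subst (λ b → indicator b ≤ sumBy (indicator ∘ p) xs) px (∈⇒≤sumBy (indicator ∘ p) x∈xs)

    allB-true : ∀ (p : A → Bool) → (∀ x → p x ≡ true) → ∀ xs → allB p xs ≡ true
    allB-true p all-true [] = refl
    allB-true p all-true (x ∷ xs) rewrite all-true x = allB-true p all-true xs

    allB-false : ∀ (p : A → Bool) {x xs} → x ∈ xs → p x ≡ false → allB p xs ≡ false
    allB-false p (here refl) px rewrite px = refl
    allB-false p {xs = y ∷ xs} (there x∈xs) px rewrite allB-false p x∈xs px = ∧-zeroʳ (p y)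

    allB-∈ : ∀ (p : A → Bool) {x xs} → allB p xs ≡ true → x ∈ xs → p x ≡ true
    allB-∈ p {xs = y ∷ xs} all-p x∈xs with p y in py
    allB-∈ p {xs = y ∷ xs} all-p (here refl) | true = py
    allB-∈ p {xs = y ∷ xs} all-p (there x∈xs) | true = allB-∈ p all-p x∈xs

  ∸-+-∸ : ∀ {a a′ b b′} → b ≤ a → b′ ≤ a′ → (a ∸ b) + (a′ ∸ b′) ≡ (a + a′) ∸ (b + b′)
  ∸-+-∸ {a} {a′} {b} {b′} b≤a b′≤a′ = begin
    (a ∸ b) + (a′ ∸ b′)   ≡⟨ ℕ.+-∸-assoc (a ∸ b) b′≤a′ ⟨
    ((a ∸ b) + a′) ∸ b′   ≡⟨ cong (_∸ b′) (ℕ.+-∸-comm a′ b≤a) ⟨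
    ((a + a′) ∸ b) ∸ b′   ≡⟨ ℕ.∸-+-assoc (a + a′) b b′ ⟩
    (a + a′) ∸ (b + b′)   ∎
    where open ≡-Reasoning

  Enumerates : ∀ {A : Set} → (A → Set) → List A → Set
  Enumerates {A} P xs = Unique xs × (∀ (x : A) → (x ∈ xs → P x) × (P x → x ∈ xs))

  module _ {A : Set} {P Q : A → Set} (f : A → A) (f-involutive : ∀ x → f (f x) ≡ x)
           (P⇒Q∘f : ∀ {x} → P x → Q (f x)) (Q⇒P∘f : ∀ {x} → Q x → P (f x)) where

    involution⇒injective : ∀ {x y} → f x ≡ f y → x ≡ y
    involution⇒injective {x} {y} fx≡fy =
      trans (sym (f-involutive x)) (trans (cong f fx≡fy) (f-involutive y))

    enumerations-↭ : ∀ {xs ys} → Enumerates P xs → Enumerates Q ys → ys ↭ map f xs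
    enumerations-↭ {xs} {ys} (xs-unique , xs-enum) (ys-unique , ys-enum) =
      ∼bag⇒↭ (unique∧set⇒bag ys-unique (Unique.map⁺ involution⇒injective xs-unique)
                (mk⇔ (ys⊆fxs _) (fxs⊆ys _)))
      where
      ys⊆fxs : ∀ y → y ∈ ys → y ∈ map f xs
      ys⊆fxs y y∈ys = subst (_∈ map f xs) (f-involutive y)
        (∈-map⁺ f (proj₂ (xs-enum (f y)) (Q⇒P∘f (proj₁ (ys-enum y) y∈ys))))
      fxs⊆ys : ∀ y → y ∈ map f xs → y ∈ ys
      fxs⊆ys y y∈fxs with ∈-map⁻ f y∈fxs
      ... | x , x∈xs , refl = proj₂ (ys-enum (f x)) (P⇒Q∘f (proj₁ (xs-enum x) x∈xs))

  nonNeg : ℤ → Bool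
  nonNeg x = isZero x ∨ isPos x

  isPos+isPos-neg : ∀ x → indicator (isPos x) + indicator (isPos (- x)) ≡ indicator (not (isZero x))
  isPos+isPos-neg +0 = refl
  isPos+isPos-neg +[1+ k ] = refl
  isPos+isPos-neg -[1+ k ] = refl

  isZero-neg : ∀ x → isZero (- x) ≡ isZero x
  isZero-neg +0 = refl
  isZero-neg +[1+ k ] = refl
  isZero-neg -[1+ k ] = refl

  nonNeg-≥0 : ∀ {x} → 0ℤ ℤ.≤ x → nonNeg x ≡ true
  nonNeg-≥0 {+0} _ = refl
  nonNeg-≥0 {+[1+ k ]} _ = refl

  nonNeg-≤0 : ∀ {x} → x ℤ.≤ 0ℤ → ¬ x ≡ 0ℤ → nonNeg x ≡ false
  nonNeg-≤0 {+0} _ x≢0 with () ← x≢0 refl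
  nonNeg-≤0 {+[1+ k ]} (ℤ.+≤+ ()) _
  nonNeg-≤0 { -[1+ k ]} _ _ = refl

  nonNeg⇒isPos : ∀ {x} → nonNeg x ≡ true → ¬ x ≡ 0ℤ → isPos x ≡ true
  nonNeg⇒isPos {+0} _ x≢0 with () ← x≢0 refl
  nonNeg⇒isPos {+[1+ k ]} _ _ = refl

  negVec-involutive : ∀ {k} (v : Vec ℤ k) → negVec (negVec v) ≡ v
  negVec-involutive v =
    trans (sym (Vec.map-∘ -_ -_ v)) (trans (Vec.map-cong ℤ.neg-involutive v) (Vec.map-id v))

  Σℤ-cong : ∀ k {f g : Fin k → ℤ} → (∀ x → f x ≡ g x) → Σℤ k f ≡ Σℤ k g
  Σℤ-cong k f≗g = cong (List.foldr ℤ._+_ 0ℤ) (List.map-cong f≗g (allFin k))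

  Σℤ-neg : ∀ k (f : Fin k → ℤ) → Σℤ k (-_ ∘ f) ≡ - Σℤ k f
  Σℤ-neg k f = foldr-neg (allFin k)
    where
    foldr-neg : ∀ xs → List.foldr ℤ._+_ 0ℤ (map (-_ ∘ f) xs) ≡ - List.foldr ℤ._+_ 0ℤ (map f xs)
    foldr-neg [] = refl
    foldr-neg (x ∷ xs) =
      trans (cong (ℤ._+_ (- f x)) (foldr-neg xs)) (sym (ℤ.neg-distrib-+ (f x) _))

  negMatrix : ∀ {m} → Matrix m → Matrix m
  negMatrix = Vec.map negVec

  module _ {m : ℕ} where

    negMatrix-involutive : ∀ (U : Matrix m) → negMatrix (negMatrix U) ≡ U
    negMatrix-involutive U = trans (sym (Vec.map-∘ negVec negVec U))
      (trans (Vec.map-cong negVec-involutive U) (Vec.map-id U))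

    entry-negMatrix : ∀ (U : Matrix m) i j → entry (negMatrix U) i j ≡ - entry U i j
    entry-negMatrix U i j = trans (cong (λ row → Vec.lookup row j) (Vec.lookup-map i negVec U))
                                  (Vec.lookup-map j -_ (Vec.lookup U i))

    negMatrix-isTesler : ∀ (U : Matrix m) → IsTesler U → IsTesler (negMatrix U)
    negMatrix-isTesler U (upper , nonzeroRow , signedRow) = upper′ , nonzeroRow′ , signedRow′
      where
      upper′ : ∀ i j → toℕ j ℕ.< toℕ i → entry (negMatrix U) i j ≡ 0ℤ
      upper′ i j j<i = trans (entry-negMatrix U i j) (cong -_ (upper i j j<i))
      nonzeroRow′ : ∀ i → ∃ λ j → ¬ entry (negMatrix U) i j ≡ 0ℤ
      nonzeroRow′ i with nonzeroRow i
      ... | j , Uij≢0 =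
        j , λ e → Uij≢0 (ℤ.neg-injective (trans (sym (entry-negMatrix U i j)) e))
      signedRow′ : ∀ i → (∀ j → 0ℤ ℤ.≤ entry (negMatrix U) i j)
                         ⊎ (∀ j → entry (negMatrix U) i j ℤ.≤ 0ℤ)
      signedRow′ i with signedRow i
      ... | inj₁ nonneg = inj₂ λ j →
        subst (ℤ._≤ 0ℤ) (sym (entry-negMatrix U i j)) (ℤ.neg-mono-≤ (nonneg j))
      ... | inj₂ nonpos = inj₁ λ j →
        subst (0ℤ ℤ.≤_) (sym (entry-negMatrix U i j)) (ℤ.neg-mono-≤ (nonpos j))

    hook-negMatrix : ∀ (U : Matrix m) i → hook (negMatrix U) i ≡ - hook U i
    hook-negMatrix U i = begin
      hook (negMatrix U) i
        ≡⟨ cong₂ ℤ._-_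
             (Σℤ-cong m (λ j → masked-neg (does (toℕ i ℕ.≤? toℕ j)) (entry-negMatrix U i j)))
             (Σℤ-cong m (λ k → masked-neg (does (toℕ k ℕ.<? toℕ i)) (entry-negMatrix U k i))) ⟩
      Σℤ m (-_ ∘ row) ℤ.- Σℤ m (-_ ∘ column)
        ≡⟨ cong₂ ℤ._-_ (Σℤ-neg m row) (Σℤ-neg m column) ⟩
      - Σℤ m row ℤ.- - Σℤ m column
        ≡⟨ ℤ.neg-distrib-+ (Σℤ m row) (- Σℤ m column) ⟨
      - hook U i ∎
      where
      open ≡-Reasoning
      row column : Fin m → ℤ
      row j = if does (toℕ i ℕ.≤? toℕ j) then entry U i j else 0ℤ
      column k = if does (toℕ k ℕ.<? toℕ i) then entry U k i else 0ℤ
      masked-neg : ∀ b {x y} → y ≡ - x → (if b then y else 0ℤ) ≡ - (if b then x else 0ℤ)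
      masked-neg b refl = sym (if-float -_ b)

    hooks-negMatrix : ∀ (U : Matrix m) → hooks (negMatrix U) ≡ negVec (hooks U)
    hooks-negMatrix U = trans (Vec.tabulate-cong (hook-negMatrix U)) (Vec.tabulate-∘ -_ (hook U))

    negMatrix-inTes : ∀ {α : Vec ℤ m} U → InTes α U → InTes (negVec α) (negMatrix U)
    negMatrix-inTes U (tesler , hooks≡α) =
      negMatrix-isTesler U tesler , trans (hooks-negMatrix U) (cong negVec hooks≡α)

    tesEnum-negVec-↭ : ∀ (α : Vec ℤ m) {L₊ L₋} → IsTesEnum α L₊ → IsTesEnum (negVec α) L₋ →
                       L₋ ↭ map negMatrix L₊
    tesEnum-negVec-↭ α = enumerations-↭ {P = InTes α} {Q = InTes (negVec α)}
      negMatrix negMatrix-involutive (λ {U} → negMatrix-inTes U)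
      (λ {U} inTes₋ →
        subst (λ β → InTes β (negMatrix U)) (negVec-involutive α) (negMatrix-inTes U inTes₋))

    -- rowsPos U and entriesPos U unfold to count m (posRow U) and sumBy (posCount U) (allFin m).
    posRow : Matrix m → Fin m → Bool
    posRow U i = allB (λ j → nonNeg (entry U i j)) (allFin m)

    posCount : Matrix m → Fin m → ℕ
    posCount U i = count m (λ j → isPos (entry U i j))

    nonNeg-negMatrix : ∀ U i j → nonNeg (entry (negMatrix U) i j) ≡ nonNeg (- entry U i j)
    nonNeg-negMatrix U i j = cong nonNeg (entry-negMatrix U i j)

    posRow-negMatrix : ∀ U → IsTesler U → ∀ i →
                       indicator (posRow U i) + indicator (posRow (negMatrix U) i) ≡ 1
    posRow-negMatrix U (_ , nonzeroRow , signedRow) i with nonzeroRow i | signedRow i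
    ... | j , Uij≢0 | inj₁ nonneg =
      cong₂ (λ a b → indicator a + indicator b)
        (allB-true _ (λ j → nonNeg-≥0 (nonneg j)) (allFin m))
        (allB-false _ (∈-allFin j)
          (trans (nonNeg-negMatrix U i j)
                 (nonNeg-≤0 (ℤ.neg-mono-≤ (nonneg j)) (Uij≢0 ∘ ℤ.neg-injective))))
    ... | j , Uij≢0 | inj₂ nonpos =
      cong₂ (λ a b → indicator a + indicator b)
        (allB-false _ (∈-allFin j) (nonNeg-≤0 (nonpos j) Uij≢0))
        (allB-true _ (λ j → trans (nonNeg-negMatrix U i j) (nonNeg-≥0 (ℤ.neg-mono-≤ (nonpos j))))
                     (allFin m))

    posRow≤posCount : ∀ U → IsTesler U → ∀ i → indicator (posRow U i) ≤ posCount U i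
    posRow≤posCount U (_ , nonzeroRow , _) i with posRow U i in rowPos | nonzeroRow i
    ... | false | _ = z≤n
    ... | true | j , Uij≢0 =
      countBy-∈ _ (∈-allFin j) (nonNeg⇒isPos (allB-∈ _ rowPos (∈-allFin j)) Uij≢0)

    rowsPos≤entriesPos : ∀ U → IsTesler U → rowsPos U ≤ entriesPos U
    rowsPos≤entriesPos U tesler =
      subst (_≤ entriesPos U) (sym (countBy≡sumBy (posRow U) (allFin m)))
        (sumBy-mono-≤ (posRow≤posCount U tesler) (allFin m))

    rowsPos-negMatrix : ∀ U → IsTesler U → rowsPos U + rowsPos (negMatrix U) ≡ m
    rowsPos-negMatrix U tesler = begin
      rowsPos U + rowsPos (negMatrix U)
        ≡⟨ countBy-+ _ _ (λ _ → true) (posRow-negMatrix U tesler) (allFin m) ⟩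
      countBy (λ _ → true) (allFin m)  ≡⟨ countBy≡sumBy _ (allFin m) ⟩
      sumBy (λ _ → 1) (allFin m)       ≡⟨ sumBy-1 (allFin m) ⟩
      List.length (allFin m)           ≡⟨ List.length-tabulate _ ⟩
      m                                ∎
      where open ≡-Reasoning

    entriesPos-negMatrix : ∀ U → entriesPos U + entriesPos (negMatrix U) ≡ nonzero U
    entriesPos-negMatrix U =
      trans (sumBy-+ (posCount U) (posCount (negMatrix U)) (allFin m))
            (sumBy-cong (λ i → countBy-+ _ _ _ (split i) (allFin m)) (allFin m))
      where
      split : ∀ i j → indicator (isPos (entry U i j)) + indicator (isPos (entry (negMatrix U) i j))
                      ≡ indicator (not (isZero (entry U i j)))
      split i j rewrite entry-negMatrix U i j = isPos+isPos-neg (entry U i j)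

    nonzero-negMatrix : ∀ U → nonzero (negMatrix U) ≡ nonzero U
    nonzero-negMatrix U =
      sumBy-cong (λ i → countBy-cong (λ j → cong not (isZero-entry i j)) (allFin m)) (allFin m)
      where
      isZero-entry : ∀ i j → isZero (entry (negMatrix U) i j) ≡ isZero (entry U i j)
      isZero-entry i j = trans (cong isZero (entry-negMatrix U i j)) (isZero-neg (entry U i j))

    module _ (U : Matrix m) (tesler : IsTesler U) where

      private
        rowsPos≤entriesPos-negMatrix : rowsPos (negMatrix U) ≤ entriesPos (negMatrix U)
        rowsPos≤entriesPos-negMatrix =
          rowsPos≤entriesPos (negMatrix U) (negMatrix-isTesler U tesler)

      m≤nonzero : m ≤ nonzero U
      m≤nonzero = subst₂ _≤_ (rowsPos-negMatrix U tesler) (entriesPos-negMatrix U)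
        (ℕ.+-mono-≤ (rowsPos≤entriesPos U tesler) rowsPos≤entriesPos-negMatrix)

      signExponent-negMatrix :
        (entriesPos U ∸ rowsPos U) + (entriesPos (negMatrix U) ∸ rowsPos (negMatrix U))
        ≡ nonzero U ∸ m
      signExponent-negMatrix =
        trans (∸-+-∸ (rowsPos≤entriesPos U tesler) rowsPos≤entriesPos-negMatrix)
              (cong₂ _∸_ (entriesPos-negMatrix U) (rowsPos-negMatrix U tesler))

open TeslerNegation

module TeslerWeight {r ℓ} (R : CommutativeRing r ℓ) where

  open CommutativeRing R
  open import Function using (_∘_)
  open import Data.Bool using (Bool; true; false; if_then_else_; not)
  open import Data.Nat as ℕ using (zero; suc; _∸_)
  open import Data.Nat.Properties using (m+[n∸m]≡n)
  open import Data.Integer as ℤ using (+0; +[1+_]; -[1+_])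
  open import Data.Fin as Fin using (Fin; toℕ)
  open import Data.List as List using ([]; _∷_; allFin)
  import Data.List.Properties as List
  open import Data.List.Membership.Propositional using (_∈_)
  open import Data.List.Relation.Unary.Any using (here; there)
  open import Data.List.Relation.Binary.Permutation.Propositional using (_↭_; ↭⇒↭ₛ′)
  import Data.List.Relation.Binary.Permutation.Propositional.Properties as ↭
  import Data.List.Relation.Binary.Permutation.Setoid.Properties as ↭ₛ
  open import Data.Maybe using (nothing)
  open import Relation.Binary.PropositionalEquality as ≡ using (_≡_)
  open import Algebra.Properties.Ring ring
    using (-1*x≈-x; -‿distribˡ-*; -‿distribʳ-*; -‿involutive; ⁻¹-anti-homo‿-)
  open import Algebra.Properties.CommutativeSemiring.Exp commutativeSemiring
    using (_^_; ^-homo-*; ^-distrib-*; ^-congˡ)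
  open import Algebra.Properties.CommutativeSemigroup *-commutativeSemigroup
    using () renaming (interchange to *-interchange)
  open import Tactic.RingSolver.Core.AlmostCommutativeRing using (fromCommutativeRing)
  open import Tactic.RingSolver.NonReflective (fromCommutativeRing R (λ _ → nothing))
    using (solve; _⊜_; _⊕_; _⊗_)
  open import Algebra.Solver.CommutativeMonoid *-commutativeMonoid
    using () renaming (solve to *-solve; _⊜_ to _⊜*_; _⊕_ to _⊛_)
  open import Relation.Binary.Reasoning.Setoid setoid

  pow≡^ : ∀ x k → pow R x k ≡ x ^ k
  pow≡^ x zero = ≡.refl
  pow≡^ x (suc k) = ≡.cong (x *_) (pow≡^ x k)

  pow-homo-* : ∀ x a b → pow R x (a ℕ.+ b) ≈ pow R x a * pow R x b
  pow-homo-* x a b rewrite pow≡^ x (a ℕ.+ b) | pow≡^ x a | pow≡^ x b = ^-homo-* x a b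

  pow-distrib-* : ∀ x y k → pow R (x * y) k ≈ pow R x k * pow R y k
  pow-distrib-* x y k rewrite pow≡^ (x * y) k | pow≡^ x k | pow≡^ y k = ^-distrib-* x y k

  pow-congˡ : ∀ k {x y} → x ≈ y → pow R x k ≈ pow R y k
  pow-congˡ k {x} {y} x≈y rewrite pow≡^ x k | pow≡^ y k = ^-congˡ k x≈y

  pow-inverse : ∀ {x y} → x * y ≈ 1# → ∀ k → pow R x k * pow R y k ≈ 1#
  pow-inverse xy≈1 zero = *-identityˡ 1#
  pow-inverse {x} {y} xy≈1 (suc k) =
    trans (*-interchange x _ y _) (trans (*-cong xy≈1 (pow-inverse xy≈1 k)) (*-identityˡ 1#))

  pow-involutive-+ : ∀ {s} → s * s ≈ 1# → ∀ {a b k} → a ℕ.+ b ≡ k →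
                     pow R s b ≈ pow R s a * pow R s k
  pow-involutive-+ {s} ss≈1 {a} {b} ≡.refl = sym (begin
    pow R s a * pow R s (a ℕ.+ b)          ≈⟨ *-congˡ (pow-homo-* s a b) ⟩
    pow R s a * (pow R s a * pow R s b)    ≈⟨ *-assoc _ _ _ ⟨
    (pow R s a * pow R s a) * pow R s b    ≈⟨ *-congʳ (pow-inverse ss≈1 a) ⟩
    1# * pow R s b                         ≈⟨ *-identityˡ _ ⟩
    pow R s b                              ∎)

  neg-*-neg : ∀ x y → (- x) * (- y) ≈ x * y
  neg-*-neg x y =
    trans (sym (-‿distribˡ-* x (- y))) (trans (-‿cong (sym (-‿distribʳ-* x y))) (-‿involutive _))

  module _ {A : Set} where

    sumᴿ prodᴿ : (A → Carrier) → List A → Carrier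
    sumᴿ f xs = List.foldr _+_ 0# (map f xs)
    prodᴿ f xs = List.foldr _*_ 1# (map f xs)

    sumᴿ-cong : ∀ {f g : A → Carrier} → (∀ x → f x ≈ g x) → ∀ xs → sumᴿ f xs ≈ sumᴿ g xs
    sumᴿ-cong f≈g [] = refl
    sumᴿ-cong f≈g (x ∷ xs) = +-cong (f≈g x) (sumᴿ-cong f≈g xs)

    sumᴿ-*ˡ : ∀ y f xs → sumᴿ (λ x → y * f x) xs ≈ y * sumᴿ f xs
    sumᴿ-*ˡ y f [] = sym (zeroʳ y)
    sumᴿ-*ˡ y f (x ∷ xs) = trans (+-congˡ (sumᴿ-*ˡ y f xs)) (sym (distribˡ y _ _))

    sumᴿ-↭ : ∀ f {xs ys} → xs ↭ ys → sumᴿ f xs ≈ sumᴿ f ys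
    sumᴿ-↭ f xs↭ys = ↭ₛ.foldr-commMonoid setoid +-isCommutativeMonoid
      (↭⇒↭ₛ′ isEquivalence (↭.map⁺ f xs↭ys))

    prodᴿ-cong : ∀ {f g : A → Carrier} → (∀ x → f x ≈ g x) → ∀ xs → prodᴿ f xs ≈ prodᴿ g xs
    prodᴿ-cong f≈g [] = refl
    prodᴿ-cong f≈g (x ∷ xs) = *-cong (f≈g x) (prodᴿ-cong f≈g xs)

    prodᴿ-* : ∀ f g xs → prodᴿ (λ x → f x * g x) xs ≈ prodᴿ f xs * prodᴿ g xs
    prodᴿ-* f g [] = sym (*-identityˡ 1#)
    prodᴿ-* f g (x ∷ xs) = trans (*-congˡ (prodᴿ-* f g xs)) (*-interchange _ _ _ _)

    prodᴿ-if : ∀ (b : A → Bool) y xs →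
               prodᴿ (λ x → if b x then 1# else y) xs ≈ pow R y (countBy (not ∘ b) xs)
    prodᴿ-if b y [] = refl
    prodᴿ-if b y (x ∷ xs) with b x
    ... | true = trans (*-identityˡ _) (prodᴿ-if b y xs)
    ... | false = *-congˡ (prodᴿ-if b y xs)

    prodᴿ-pow : ∀ y g xs → prodᴿ (λ x → pow R y (g x)) xs ≈ pow R y (sumBy g xs)
    prodᴿ-pow y g [] = refl
    prodᴿ-pow y g (x ∷ xs) = trans (*-congˡ (prodᴿ-pow y g xs)) (sym (pow-homo-* y (g x) _))

  module _ {m : ℕ} where

    Π² : (Fin m → Fin m → Carrier) → Carrier
    Π² f = Πᴿ R m (λ i → Πᴿ R m (f i))

    Π²-cong : ∀ {f g} → (∀ i j → f i j ≈ g i j) → Π² f ≈ Π² g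
    Π²-cong f≈g = prodᴿ-cong (λ i → prodᴿ-cong (f≈g i) (allFin m)) (allFin m)

    Π²-* : ∀ f g → Π² (λ i j → f i j * g i j) ≈ Π² f * Π² g
    Π²-* f g = trans (prodᴿ-cong (λ i → prodᴿ-* (f i) (g i) (allFin m)) (allFin m))
                     (prodᴿ-* _ _ (allFin m))

    Π²-if-isZero : ∀ y (U : Matrix m) →
                   Π² (λ i j → if isZero (entry U i j) then 1# else y) ≈ pow R y (nonzero U)
    Π²-if-isZero y U =
      trans (prodᴿ-cong (λ i → prodᴿ-if (λ j → isZero (entry U i j)) y (allFin m)) (allFin m))
            (prodᴿ-pow y _ (allFin m))

  Σᴿ-suc : ∀ k (f : Fin (suc k) → Carrier) → Σᴿ R (suc k) f ≡ f Fin.zero + Σᴿ R k (f ∘ Fin.suc)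
  Σᴿ-suc k f = ≡.cong (λ rest → f Fin.zero + List.foldr _+_ 0# rest)
    (≡.trans (List.map-tabulate Fin.suc f) (≡.sym (List.map-tabulate (λ a → a) (f ∘ Fin.suc))))

  qtPos-zero : ∀ x y → qtPos R x y 0 ≈ 1#
  qtPos-zero x y = trans (+-identityʳ _) (*-identityˡ 1#)

  qtPos-suc : ∀ x y k → qtPos R x y (suc k) ≈ pow R y (suc k) + x * qtPos R x y k
  qtPos-suc x y k = begin
    qtPos R x y (suc k)
      ≡⟨ Σᴿ-suc (suc k) _ ⟩
    1# * pow R y (suc k) + Σᴿ R (suc k) (λ a → (x * pow R x (toℕ a)) * pow R y (k ∸ toℕ a))
      ≈⟨ +-cong (*-identityˡ _) (sumᴿ-cong (λ a → *-assoc x _ _) (allFin (suc k))) ⟩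
    pow R y (suc k) + Σᴿ R (suc k) (λ a → x * (pow R x (toℕ a) * pow R y (k ∸ toℕ a)))
      ≈⟨ +-congˡ (sumᴿ-*ˡ x _ (allFin (suc k))) ⟩
    pow R y (suc k) + x * qtPos R x y k ∎

  qtPos-suc′ : ∀ x y k → qtPos R x y (suc k) ≈ pow R x (suc k) + y * qtPos R x y k
  qtPos-suc′ x y zero = begin
    qtPos R x y 1
      ≈⟨ qtPos-suc x y 0 ⟩
    y * 1# + x * qtPos R x y 0
      ≈⟨ +-cong (*-congˡ (sym (qtPos-zero x y))) (*-congˡ (qtPos-zero x y)) ⟩
    y * qtPos R x y 0 + x * 1#
      ≈⟨ +-comm _ _ ⟩
    x * 1# + y * qtPos R x y 0 ∎
  qtPos-suc′ x y (suc k) = begin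
    qtPos R x y (suc (suc k))
      ≈⟨ qtPos-suc x y (suc k) ⟩
    y * pow R y (suc k) + x * qtPos R x y (suc k)
      ≈⟨ +-congˡ (*-congˡ (qtPos-suc′ x y k)) ⟩
    y * pow R y (suc k) + x * (pow R x (suc k) + y * qtPos R x y k)
      ≈⟨ solve 5 (λ x y X Y Q → ((y ⊗ Y) ⊕ (x ⊗ (X ⊕ (y ⊗ Q))))
                               ⊜ ((x ⊗ X) ⊕ (y ⊗ (Y ⊕ (x ⊗ Q)))))
               refl x y (pow R x (suc k)) (pow R y (suc k)) (qtPos R x y k) ⟩
    x * pow R x (suc k) + y * (pow R y (suc k) + x * qtPos R x y k)
      ≈⟨ +-congˡ (*-congˡ (qtPos-suc x y k)) ⟨
    x * pow R x (suc k) + y * qtPos R x y (suc k) ∎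

  qtPos-reciprocal : ∀ {q u t v} → q * u ≈ 1# → t * v ≈ 1# →
                     ∀ k → pow R (u * v) k * qtPos R q t k ≈ qtPos R u v k
  qtPos-reciprocal qu≈1 tv≈1 zero = *-identityˡ _
  qtPos-reciprocal {q} {u} {t} {v} qu≈1 tv≈1 (suc k) = begin
    pow R (u * v) (suc k) * qtPos R q t (suc k)
      ≈⟨ *-congˡ (qtPos-suc q t k) ⟩
    pow R (u * v) (suc k) * (pow R t (suc k) + q * qtPos R q t k)
      ≈⟨ distribˡ _ _ _ ⟩
    pow R (u * v) (suc k) * pow R t (suc k) + pow R (u * v) (suc k) * (q * qtPos R q t k)
      ≈⟨ +-cong leading rest ⟩
    pow R u (suc k) + v * qtPos R u v k
      ≈⟨ qtPos-suc′ u v k ⟨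
    qtPos R u v (suc k) ∎
    where
    leading : pow R (u * v) (suc k) * pow R t (suc k) ≈ pow R u (suc k)
    leading = begin
      pow R (u * v) (suc k) * pow R t (suc k)  ≈⟨ pow-distrib-* (u * v) t (suc k) ⟨
      pow R ((u * v) * t) (suc k)
        ≈⟨ pow-congˡ (suc k) (trans (*-assoc u v t)
             (trans (*-congˡ (trans (*-comm v t) tv≈1)) (*-identityʳ u))) ⟩
      pow R u (suc k)                          ∎
    rest : pow R (u * v) (suc k) * (q * qtPos R q t k) ≈ v * qtPos R u v k
    rest = begin
      ((u * v) * pow R (u * v) k) * (q * qtPos R q t k)
        ≈⟨ *-solve 5 (λ u v X q Q → (((u ⊛ v) ⊛ X) ⊛ (q ⊛ Q)) ⊜* (v ⊛ ((u ⊛ q) ⊛ (X ⊛ Q))))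
                 refl u v (pow R (u * v) k) q (qtPos R q t k) ⟩
      v * ((u * q) * (pow R (u * v) k * qtPos R q t k))
        ≈⟨ *-congˡ (*-cong (trans (*-comm u q) qu≈1) (qtPos-reciprocal qu≈1 tv≈1 k)) ⟩
      v * (1# * qtPos R u v k)  ≈⟨ *-congˡ (*-identityˡ _) ⟩
      v * qtPos R u v k         ∎

  entryFactor : (q q⁻¹ t t⁻¹ : Carrier) → ℤ → Carrier
  entryFactor q q⁻¹ t t⁻¹ x = if isZero x then 1# else qtInt R q q⁻¹ t t⁻¹ x

  module _ {q u t v : Carrier} (qu≈1 : q * u ≈ 1#) (tv≈1 : t * v ≈ 1#) where

    private
      uq≈1 : u * q ≈ 1#
      uq≈1 = trans (*-comm u q) qu≈1

      vt≈1 : v * t ≈ 1#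
      vt≈1 = trans (*-comm v t) tv≈1

    entryFactor-neg : ∀ x → entryFactor q u t v (ℤ.- x)
                            ≈ (if isZero x then 1# else - (u * v)) * entryFactor u q v t x
    entryFactor-neg +0 = sym (*-identityˡ 1#)
    entryFactor-neg +[1+ k ] = begin
      - (((u * v) * pow R (u * v) k) * qtPos R q t k)  ≈⟨ -‿cong (*-assoc _ _ _) ⟩
      - ((u * v) * (pow R (u * v) k * qtPos R q t k))  ≈⟨ -‿distribˡ-* _ _ ⟩
      - (u * v) * (pow R (u * v) k * qtPos R q t k)
        ≈⟨ *-congˡ (qtPos-reciprocal qu≈1 tv≈1 k) ⟩
      - (u * v) * qtPos R u v k                        ∎
    entryFactor-neg -[1+ k ] = sym (begin
      - (u * v) * - (((q * t) * pow R (q * t) k) * qtPos R u v k) ≈⟨ neg-*-neg _ _ ⟩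
      (u * v) * (((q * t) * pow R (q * t) k) * qtPos R u v k)     ≈⟨ *-congˡ (*-assoc _ _ _) ⟩
      (u * v) * ((q * t) * (pow R (q * t) k * qtPos R u v k))     ≈⟨ *-assoc _ _ _ ⟨
      ((u * v) * (q * t)) * (pow R (q * t) k * qtPos R u v k)
        ≈⟨ *-cong uvqt≈1 (qtPos-reciprocal uq≈1 vt≈1 k) ⟩
      1# * qtPos R q t k                                          ≈⟨ *-identityˡ _ ⟩
      qtPos R q t k                                               ∎)
      where
      uvqt≈1 : (u * v) * (q * t) ≈ 1#
      uvqt≈1 = trans (*-interchange u v q t) (trans (*-cong uq≈1 vt≈1) (*-identityˡ 1#))

    entryProduct-negMatrix : ∀ {m} (U : Matrix m) →
      Π² (λ i j → entryFactor q u t v (entry (negMatrix U) i j))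
      ≈ pow R (- (u * v)) (nonzero U) * Π² (λ i j → entryFactor u q v t (entry U i j))
    entryProduct-negMatrix U = begin
      Π² (λ i j → entryFactor q u t v (entry (negMatrix U) i j))
        ≈⟨ Π²-cong (λ i j → trans (reflexive (≡.cong (entryFactor q u t v) (entry-negMatrix U i j)))
                                  (entryFactor-neg (entry U i j))) ⟩
      Π² (λ i j → (if isZero (entry U i j) then 1# else - (u * v)) * entryFactor u q v t (entry U i j))
        ≈⟨ Π²-* (λ i j → if isZero (entry U i j) then 1# else - (u * v))
                (λ i j → entryFactor u q v t (entry U i j)) ⟩
      Π² (λ i j → if isZero (entry U i j) then 1# else - (u * v))
        * Π² (λ i j → entryFactor u q v t (entry U i j))
        ≈⟨ *-congʳ (Π²-if-isZero (- (u * v)) U) ⟩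
      pow R (- (u * v)) (nonzero U) * Π² (λ i j → entryFactor u q v t (entry U i j)) ∎

    Mqt-inverse : ((- 1#) * Mqt R q t) * (- (u * v)) ≈ Mqt R u v
    Mqt-inverse = begin
      ((- 1#) * ((1# - q) * (1# - t))) * (- (u * v))   ≈⟨ *-congʳ (-1*x≈-x _) ⟩
      (- ((1# - q) * (1# - t))) * (- (u * v))          ≈⟨ neg-*-neg _ _ ⟩
      ((1# - q) * (1# - t)) * (u * v)                  ≈⟨ *-interchange _ _ _ _ ⟩
      ((1# - q) * u) * ((1# - t) * v)                  ≈⟨ *-cong (one-minus qu≈1) (one-minus tv≈1) ⟩
      (- (1# - u)) * (- (1# - v))                      ≈⟨ neg-*-neg _ _ ⟩
      (1# - u) * (1# - v)                              ∎
      where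
      one-minus : ∀ {x y} → x * y ≈ 1# → (1# - x) * y ≈ - (1# - y)
      one-minus {x} {y} xy≈1 = begin
        (1# - x) * y       ≈⟨ distribʳ y 1# (- x) ⟩
        1# * y + - x * y   ≈⟨ +-cong (*-identityˡ y) (trans (sym (-‿distribˡ-* x y)) (-‿cong xy≈1)) ⟩
        y - 1#             ≈⟨ ⁻¹-anti-homo‿- 1# y ⟨
        - (1# - y)         ∎

    wt-negMatrix : ∀ {m} (U : Matrix m) → IsTesler U →
                   wt R q u t v (negMatrix U) ≈ pow R (- (u * v)) m * wt R u q v t U
    wt-negMatrix {m} U tesler = begin
      pow R s B * (pow R M (nonzero (negMatrix U) ∸ m) * Π₋)
        ≈⟨ *-cong (pow-involutive-+ s*s≈1 {A} {B} (signExponent-negMatrix U tesler))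
                  (*-cong (reflexive (≡.cong (λ z → pow R M (z ∸ m)) (nonzero-negMatrix U)))
                          (entryProduct-negMatrix U)) ⟩
      (pow R s A * pow R s k) * (pow R M k * (pow R c (nonzero U) * Π₊))
        ≈⟨ *-congˡ (*-congˡ (*-congʳ
             (trans (reflexive (≡.cong (pow R c) nonzero≡m+k)) (pow-homo-* c m k)))) ⟩
      (pow R s A * pow R s k) * (pow R M k * ((pow R c m * pow R c k) * Π₊))
        ≈⟨ *-solve 6 (λ sA sk Mk cm ck Π → ((sA ⊛ sk) ⊛ (Mk ⊛ ((cm ⊛ ck) ⊛ Π)))
                                        ⊜* (cm ⊛ (sA ⊛ (((sk ⊛ Mk) ⊛ ck) ⊛ Π))))
                   refl (pow R s A) (pow R s k) (pow R M k) (pow R c m) (pow R c k) Π₊ ⟩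
      pow R c m * (pow R s A * (((pow R s k * pow R M k) * pow R c k) * Π₊))
        ≈⟨ *-congˡ (*-congˡ (*-congʳ collect)) ⟩
      pow R c m * (pow R s A * (pow R (Mqt R u v) k * Π₊)) ∎
      where
      s c M : Carrier
      s = - 1#
      c = - (u * v)
      M = Mqt R q t
      A B k : ℕ
      A = entriesPos U ∸ rowsPos U
      B = entriesPos (negMatrix U) ∸ rowsPos (negMatrix U)
      k = nonzero U ∸ m
      Π₋ Π₊ : Carrier
      Π₋ = Π² (λ i j → entryFactor q u t v (entry (negMatrix U) i j))
      Π₊ = Π² (λ i j → entryFactor u q v t (entry U i j))
      s*s≈1 : s * s ≈ 1#
      s*s≈1 = trans (neg-*-neg 1# 1#) (*-identityˡ 1#)
      nonzero≡m+k : nonzero U ≡ m ℕ.+ k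
      nonzero≡m+k = ≡.sym (m+[n∸m]≡n (m≤nonzero U tesler))
      collect : (pow R s k * pow R M k) * pow R c k ≈ pow R (Mqt R u v) k
      collect = begin
        (pow R s k * pow R M k) * pow R c k  ≈⟨ *-congʳ (pow-distrib-* s M k) ⟨
        pow R (s * M) k * pow R c k          ≈⟨ pow-distrib-* (s * M) c k ⟨
        pow R ((s * M) * c) k                ≈⟨ pow-congˡ k Mqt-inverse ⟩
        pow R (Mqt R u v) k                  ∎

    TesSum-negMatrix : ∀ {m} (L : List (Matrix m)) → (∀ U → U ∈ L → IsTesler U) →
                       TesSum R q u t v (map negMatrix L) ≈ pow R (- (u * v)) m * TesSum R u q v t L
    TesSum-negMatrix [] _ = sym (zeroʳ _)
    TesSum-negMatrix (U ∷ L) tesler = trans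
      (+-cong (wt-negMatrix U (tesler U (here ≡.refl)))
              (TesSum-negMatrix L (λ W W∈L → tesler W (there W∈L))))
      (sym (distribˡ _ _ _))

open TeslerWeight

lemma4p6 : ∀ {c ℓ} (R : CommutativeRing c ℓ) →
    let open CommutativeRing R in
    (q q⁻¹ t t⁻¹ : Carrier) → q * q⁻¹ ≈ 1# → t * t⁻¹ ≈ 1# →
    (n : ℕ) → 1 ≤ n → (α : Vec ℤ n) →
    (L₋ : List (Matrix n)) → IsTesEnum (negVec α) L₋ →
    (L₊ : List (Matrix n)) → IsTesEnum α L₊ →
    TesSum R q q⁻¹ t t⁻¹ L₋ ≈ pow R (- (q⁻¹ * t⁻¹)) n * TesSum R q⁻¹ q t⁻¹ t L₊
lemma4p6 R q q⁻¹ t t⁻¹ qq⁻¹≈1 tt⁻¹≈1 n _ α L₋ enum₋ L₊ enum₊ = begin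
  TesSum R q q⁻¹ t t⁻¹ L₋
    ≈⟨ sumᴿ-↭ R (wt R q q⁻¹ t t⁻¹) (tesEnum-negVec-↭ α enum₊ enum₋) ⟩
  TesSum R q q⁻¹ t t⁻¹ (map negMatrix L₊)
    ≈⟨ TesSum-negMatrix R qq⁻¹≈1 tt⁻¹≈1 L₊ (λ U U∈L₊ → proj₁ (proj₁ (proj₂ enum₊ U) U∈L₊)) ⟩
  pow R (- (q⁻¹ * t⁻¹)) n * TesSum R q⁻¹ q t⁻¹ t L₊ ∎
  where
  open CommutativeRing R
  open import Relation.Binary.Reasoning.Setoid setoid
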